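{- Let $E$ be a principal ideal domain and let $f_1,f_2\in E[x]$ with $\gcd(f_1,f_2)=1$. Then the ideal $(f_1,f_2)\subseteq E[x]$ contains both a nonzero element $c$ of $E$ and a monic polynomial of $E[x]$. Moreover, if $c\in (f_1,f_2)\cap E$ is nonzero and $E/(c)$ is finite, then $E[x]/(f_1,f_2)$ is finite.
   Context: $(f_1,f_2)$ is the ideal of $E[x]$ generated by $f_1,f_2$. -}

module Defs where

open import Level using (Level; _⊔_) renaming (suc to lsuc)
open import Algebra.Bundles using (CommutativeRing)
import Algebra.Definitions.RawMagma as RawMagmaDefs
open import Data.Nat using (ℕ; zero; suc; _<_)
open import Data.List using (List; []; _∷_)
open import Data.List.Relation.Unary.Any using (Any)
open import Data.Product using (Σ; ∃; _×_; _,_)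
open import Relation.Nullary using (¬_)
open import Relation.Unary using (Pred)
import Data.Sum

module Ring {c ℓ : Level} (E : CommutativeRing c ℓ) where

  open CommutativeRing E public
  open RawMagmaDefs *-rawMagma public using (_∣_)

  record IsIdeal (I : Pred Carrier (c ⊔ ℓ)) : Set (c ⊔ ℓ) where
    field
      resp   : ∀ {x y} → x ≈ y → I x → I y
      zero∈  : I 0#
      +-closed : ∀ {x y} → I x → I y → I (x + y)
      *-closed : ∀ r {x} → I x → I (r * x)

  IsPrincipal : Pred Carrier (c ⊔ ℓ) → Set (c ⊔ ℓ)
  IsPrincipal I = ∃ λ a → ∀ x → (I x → a ∣ x) × (a ∣ x → I x)

  record IsIntegralDomain : Set (c ⊔ ℓ) where
    field
      nontrivial : ¬ (1# ≈ 0#)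
      noZeroDivisors : ∀ {x y} → x * y ≈ 0# → (x ≈ 0#) Data.Sum.⊎ (y ≈ 0#)

  record IsPID : Set (lsuc (c ⊔ ℓ)) where
    field
      isIntegralDomain : IsIntegralDomain
      principal : ∀ (I : Pred Carrier (c ⊔ ℓ)) → IsIdeal I → IsPrincipal I

  FiniteQuotient : Carrier → Set (c ⊔ ℓ)
  FiniteQuotient a = ∃ λ (reps : List Carrier) → ∀ x → Any (λ y → a ∣ (x - y)) reps

  -- The polynomial ring E[x]: coefficient lists, lowest degree first,
  -- equality = equality of all coefficients (trailing zeros ignored).

  Poly : Set c
  Poly = List Carrier

  coeff : Poly → ℕ → Carrier
  coeff []       _       = 0#
  coeff (a ∷ p)  zero    = a
  coeff (a ∷ p)  (suc n) = coeff p n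

  infix 4 _≋_
  _≋_ : Poly → Poly → Set ℓ
  p ≋ q = ∀ n → coeff p n ≈ coeff q n

  infixl 6 _+ₚ_ _-ₚ_
  infixl 7 _*ₚ_ _·ₚ_

  _+ₚ_ : Poly → Poly → Poly
  []      +ₚ q       = q
  (a ∷ p) +ₚ []      = a ∷ p
  (a ∷ p) +ₚ (b ∷ q) = (a + b) ∷ (p +ₚ q)

  -ₚ_ : Poly → Poly
  -ₚ []      = []
  -ₚ (a ∷ p) = (- a) ∷ (-ₚ p)

  _-ₚ_ : Poly → Poly → Poly
  p -ₚ q = p +ₚ (-ₚ q)

  _·ₚ_ : Carrier → Poly → Poly
  a ·ₚ []      = []
  a ·ₚ (b ∷ q) = (a * b) ∷ (a ·ₚ q)

  _*ₚ_ : Poly → Poly → Poly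
  []      *ₚ q = []
  (a ∷ p) *ₚ q = (a ·ₚ q) +ₚ (0# ∷ (p *ₚ q))

  const : Carrier → Poly
  const a = a ∷ []

  1ₚ : Poly
  1ₚ = const 1#

  infix 4 _∣ₚ_
  _∣ₚ_ : Poly → Poly → Set (c ⊔ ℓ)
  g ∣ₚ f = ∃ λ h → h *ₚ g ≋ f

  IsUnitₚ : Poly → Set (c ⊔ ℓ)
  IsUnitₚ u = u ∣ₚ 1ₚ

  GcdOne : Poly → Poly → Set (c ⊔ ℓ)
  GcdOne f₁ f₂ = ∀ g → g ∣ₚ f₁ → g ∣ₚ f₂ → IsUnitₚ g

  InIdeal₂ : Poly → Poly → Poly → Set (c ⊔ ℓ)
  InIdeal₂ f₁ f₂ h = ∃ λ g₁ → ∃ λ g₂ → g₁ *ₚ f₁ +ₚ g₂ *ₚ f₂ ≋ h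

  Monic : Poly → Set ℓ
  Monic h = Σ ℕ λ n → (coeff h n ≈ 1#) × (∀ m → n < m → coeff h m ≈ 0#)

  FiniteQuotient₂ : Poly → Poly → Set (c ⊔ ℓ)
  FiniteQuotient₂ f₁ f₂ =
    ∃ λ (reps : List Poly) → ∀ p → Any (λ q → InIdeal₂ f₁ f₂ (p -ₚ q)) reps

{-# OPTIONS --safe #-}
-- Since every ideal of E is principal, the ideal {x | P or x ≈ 0} is too, which yields excluded
-- middle; so degrees and elements of least degree are available.
--
-- Constant: let g be an element of least degree of I = (f₁, f₂) and g = d · g′ with g′ primitive.
-- Pseudo-division by g leaves no remainder in I, and Gauss's lemma cancels the powers of the
-- leading coefficient of g, so g′ divides every element of I, in particular f₁ and f₂. Hence g′
-- is a unit and the constant d lies in I.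
--
-- Monic: the leading coefficients of the elements of I of degree ≤ k form an ideal (l k). Given a
-- nonzero constant in I, each l k is nonzero, and by induction on k, l k divides every coefficient
-- of every element of I of degree ≤ k. For k beyond the degrees of f₁ and f₂ this makes l k a
-- common divisor of f₁ and f₂, hence a unit, and the element of I with leading coefficient l k,
-- divided by l k, is monic.
--
-- Finiteness: modulo a monic element of I of degree n, every polynomial reduces to one of degree
-- < n, and modulo a constant c of I only the residues of its n coefficients modulo c matter.
module Submission where

open import Defs
open import Level using (Level; _⊔_; Lift; lift; lower)
open import Algebra.Bundles using (CommutativeRing)
import Algebra.Properties.Ring as RingProperties
import Algebra.Properties.CommutativeSemigroup as CommutativeSemigroupProperties
open import Data.Nat using (ℕ; zero; suc; _≤_; _<_; _∸_; z≤n; s≤s; s≤s⁻¹) renaming (_+_ to _+ℕ_)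
open import Data.Nat.Properties
  using (≤-trans; n≤1+n; m≤m+n; m≤n+m; ≤-reflexive; +-suc; m∸n+n≡m; m≤n⇒m<n∨m≡n; _≤?_; _<?_; ≰⇒>; ≮⇒≥)
open import Data.Nat.Induction using (<-rec)
open import Data.List using (List; []; _∷_; length; drop; cartesianProductWith)
open import Data.List.Relation.Unary.Any as Any using (Any; here)
open import Data.List.Relation.Unary.Any.Properties using (cartesianProductWith⁺)
open import Data.Product using (∃; ∃₂; _×_; _,_; proj₁; proj₂)
open import Data.Sum using (_⊎_; inj₁; inj₂)
open import Data.Empty using (⊥-elim)
open import Relation.Nullary using (¬_; Dec; yes; no)
open import Relation.Nullary.Decidable using (map′)
open import Relation.Unary using (Pred)
open import Relation.Binary.Bundles using (Setoid)
open import Relation.Binary.PropositionalEquality using (_≡_; subst; cong) renaming (refl to ≡-refl; trans to ≡-trans)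
import Relation.Binary.Reasoning.Setoid as SetoidReasoning

module Polynomials {c ℓ : Level} (E : CommutativeRing c ℓ) where
  open Ring E public
  open import Algebra.Definitions.RawMagma *-rawMagma using (_,_)
  open RingProperties ring using (-1*x≈-x; -0#≈0#)
  open import Algebra.Properties.Semiring.Divisibility semiring public
    using (∣ʳ-refl; ∣ʳ-trans; ∣ʳ-respˡ-≈; ∣ʳ-respʳ-≈; x∣ʳy⇒x∣ʳzy; _∣0; 0∣x⇒x≈0; x∣y∧y≉0⇒x≉0)
  open import Algebra.Properties.AbelianGroup +-abelianGroup using (⁻¹-∙-comm)
  open import Algebra.Properties.Group +-group using (⁻¹-involutive)
  open CommutativeSemigroupProperties +-commutativeSemigroup using (interchange; x∙yz≈y∙xz)
  open CommutativeSemigroupProperties *-commutativeSemigroup using () renaming (x∙yz≈y∙xz to x*[y*z]≈y*[x*z])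
  private module ≈-Reasoning = SetoidReasoning setoid

  coeff-+ : ∀ p q n → coeff (p +ₚ q) n ≈ coeff p n + coeff q n
  coeff-+ []      q       n       = sym (+-identityˡ _)
  coeff-+ (a ∷ p) []      n       = sym (+-identityʳ _)
  coeff-+ (a ∷ p) (b ∷ q) zero    = refl
  coeff-+ (a ∷ p) (b ∷ q) (suc n) = coeff-+ p q n

  coeff-‿ : ∀ p n → coeff (-ₚ p) n ≈ - coeff p n
  coeff-‿ []      n       = sym -0#≈0#
  coeff-‿ (a ∷ p) zero    = refl
  coeff-‿ (a ∷ p) (suc n) = coeff-‿ p n

  coeff-· : ∀ a p n → coeff (a ·ₚ p) n ≈ a * coeff p n
  coeff-· a []      n       = sym (zeroʳ a)
  coeff-· a (b ∷ p) zero    = refl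
  coeff-· a (b ∷ p) (suc n) = coeff-· a p n

  coeff-- : ∀ p q n → coeff (p -ₚ q) n ≈ coeff p n - coeff q n
  coeff-- p q n = trans (coeff-+ p (-ₚ q) n) (+-congˡ (coeff-‿ q n))

  -- A record rather than Defs' _≋_, so that p and q can be inferred from a proof of p ≈ₚ q.
  infix 4 _≈ₚ_
  record _≈ₚ_ (p q : Poly) : Set ℓ where
    constructor coeffwise
    field at : ∀ n → coeff p n ≈ coeff q n
  open _≈ₚ_ public

  ≈ₚ-refl : ∀ {p} → p ≈ₚ p
  ≈ₚ-refl = coeffwise λ _ → refl

  ≈ₚ-sym : ∀ {p q} → p ≈ₚ q → q ≈ₚ p
  ≈ₚ-sym e = coeffwise λ n → sym (at e n)

  ≈ₚ-trans : ∀ {p q r} → p ≈ₚ q → q ≈ₚ r → p ≈ₚ r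
  ≈ₚ-trans e f = coeffwise λ n → trans (at e n) (at f n)

  ≈ₚ-setoid : Setoid c ℓ
  ≈ₚ-setoid = record
    { Carrier = Poly
    ; _≈_ = _≈ₚ_
    ; isEquivalence = record { refl = ≈ₚ-refl ; sym = ≈ₚ-sym ; trans = ≈ₚ-trans }
    }

  module ≈ₚ-Reasoning = SetoidReasoning ≈ₚ-setoid

  ∷-cong : ∀ {a b p q} → a ≈ b → p ≈ₚ q → a ∷ p ≈ₚ b ∷ q
  ∷-cong a≈b p≈q = coeffwise λ where
    zero    → a≈b
    (suc n) → at p≈q n

  ∷-congʳ : ∀ {a b p q} → a ∷ p ≈ₚ b ∷ q → p ≈ₚ q
  ∷-congʳ e = coeffwise λ n → at e (suc n)

  ∷≈[]⇒≈[] : ∀ {a p} → a ∷ p ≈ₚ [] → p ≈ₚ []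
  ∷≈[]⇒≈[] e = coeffwise λ n → at e (suc n)

  +ₚ-cong : ∀ {p p′ q q′} → p ≈ₚ p′ → q ≈ₚ q′ → p +ₚ q ≈ₚ p′ +ₚ q′
  +ₚ-cong {p} {p′} {q} {q′} e f = coeffwise λ n → begin
    coeff (p +ₚ q) n        ≈⟨ coeff-+ p q n ⟩
    coeff p n + coeff q n   ≈⟨ +-cong (at e n) (at f n) ⟩
    coeff p′ n + coeff q′ n ≈⟨ coeff-+ p′ q′ n ⟨
    coeff (p′ +ₚ q′) n      ∎
    where open ≈-Reasoning

  ·ₚ-cong : ∀ {a b p q} → a ≈ b → p ≈ₚ q → a ·ₚ p ≈ₚ b ·ₚ q
  ·ₚ-cong {a} {b} {p} {q} a≈b e = coeffwise λ n → begin
    coeff (a ·ₚ p) n ≈⟨ coeff-· a p n ⟩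
    a * coeff p n    ≈⟨ *-cong a≈b (at e n) ⟩
    b * coeff q n    ≈⟨ coeff-· b q n ⟨
    coeff (b ·ₚ q) n ∎
    where open ≈-Reasoning

  +ₚ-identityʳ : ∀ p → p +ₚ [] ≈ₚ p
  +ₚ-identityʳ []      = ≈ₚ-refl
  +ₚ-identityʳ (a ∷ p) = ≈ₚ-refl

  +ₚ-interchange : ∀ p q r s → (p +ₚ q) +ₚ (r +ₚ s) ≈ₚ (p +ₚ r) +ₚ (q +ₚ s)
  +ₚ-interchange p q r s = coeffwise λ n → begin
    coeff ((p +ₚ q) +ₚ (r +ₚ s)) n                    ≈⟨ coeff-+ (p +ₚ q) (r +ₚ s) n ⟩
    coeff (p +ₚ q) n + coeff (r +ₚ s) n               ≈⟨ +-cong (coeff-+ p q n) (coeff-+ r s n) ⟩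
    (coeff p n + coeff q n) + (coeff r n + coeff s n) ≈⟨ interchange _ _ _ _ ⟩
    (coeff p n + coeff r n) + (coeff q n + coeff s n) ≈⟨ +-cong (coeff-+ p r n) (coeff-+ q s n) ⟨
    coeff (p +ₚ r) n + coeff (q +ₚ s) n               ≈⟨ coeff-+ (p +ₚ r) (q +ₚ s) n ⟨
    coeff ((p +ₚ r) +ₚ (q +ₚ s)) n                    ∎
    where open ≈-Reasoning

  -ₚ≈-1·ₚ : ∀ p → -ₚ p ≈ₚ (- 1#) ·ₚ p
  -ₚ≈-1·ₚ p = coeffwise λ n → begin
    coeff (-ₚ p) n          ≈⟨ coeff-‿ p n ⟩
    - coeff p n             ≈⟨ -1*x≈-x _ ⟨
    - 1# * coeff p n        ≈⟨ coeff-· (- 1#) p n ⟨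
    coeff ((- 1#) ·ₚ p) n   ∎
    where open ≈-Reasoning

  p-q+q≈p : ∀ p q → (p -ₚ q) +ₚ q ≈ₚ p
  p-q+q≈p p q = coeffwise λ n → begin
    coeff ((p -ₚ q) +ₚ q) n           ≈⟨ trans (coeff-+ (p -ₚ q) q n) (+-congʳ (coeff-- p q n)) ⟩
    (coeff p n - coeff q n) + coeff q n ≈⟨ +-assoc _ _ _ ⟩
    coeff p n + (- coeff q n + coeff q n) ≈⟨ +-congˡ (-‿inverseˡ _) ⟩
    coeff p n + 0#                    ≈⟨ +-identityʳ _ ⟩
    coeff p n                         ∎
    where open ≈-Reasoning

  [p-q]+[q-r]≈p-r : ∀ p q r → (p -ₚ q) +ₚ (q -ₚ r) ≈ₚ p -ₚ r
  [p-q]+[q-r]≈p-r p q r = coeffwise λ n → begin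
    coeff ((p -ₚ q) +ₚ (q -ₚ r)) n
      ≈⟨ trans (coeff-+ (p -ₚ q) (q -ₚ r) n) (+-cong (coeff-- p q n) (coeff-- q r n)) ⟩
    (coeff p n - coeff q n) + (coeff q n - coeff r n)
      ≈⟨ +-assoc _ _ _ ⟩
    coeff p n + (- coeff q n + (coeff q n - coeff r n))
      ≈⟨ +-congˡ (trans (sym (+-assoc _ _ _)) (trans (+-congʳ (-‿inverseˡ _)) (+-identityˡ _))) ⟩
    coeff p n - coeff r n
      ≈⟨ coeff-- p r n ⟨
    coeff (p -ₚ r) n ∎
    where open ≈-Reasoning

  ·ₚ-distribˡ : ∀ a p q → a ·ₚ (p +ₚ q) ≈ₚ a ·ₚ p +ₚ a ·ₚ q
  ·ₚ-distribˡ a p q = coeffwise λ n → begin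
    coeff (a ·ₚ (p +ₚ q)) n             ≈⟨ trans (coeff-· a (p +ₚ q) n) (*-congˡ (coeff-+ p q n)) ⟩
    a * (coeff p n + coeff q n)         ≈⟨ distribˡ _ _ _ ⟩
    a * coeff p n + a * coeff q n       ≈⟨ +-cong (coeff-· a p n) (coeff-· a q n) ⟨
    coeff (a ·ₚ p) n + coeff (a ·ₚ q) n ≈⟨ coeff-+ (a ·ₚ p) (a ·ₚ q) n ⟨
    coeff (a ·ₚ p +ₚ a ·ₚ q) n          ∎
    where open ≈-Reasoning

  ·ₚ-distribʳ : ∀ a b p → (a + b) ·ₚ p ≈ₚ a ·ₚ p +ₚ b ·ₚ p
  ·ₚ-distribʳ a b p = coeffwise λ n → begin
    coeff ((a + b) ·ₚ p) n              ≈⟨ coeff-· (a + b) p n ⟩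
    (a + b) * coeff p n                 ≈⟨ distribʳ _ _ _ ⟩
    a * coeff p n + b * coeff p n       ≈⟨ +-cong (coeff-· a p n) (coeff-· b p n) ⟨
    coeff (a ·ₚ p) n + coeff (b ·ₚ p) n ≈⟨ coeff-+ (a ·ₚ p) (b ·ₚ p) n ⟨
    coeff (a ·ₚ p +ₚ b ·ₚ p) n          ∎
    where open ≈-Reasoning

  ·ₚ-assoc : ∀ a b p → a ·ₚ (b ·ₚ p) ≈ₚ (a * b) ·ₚ p
  ·ₚ-assoc a b p = coeffwise λ n → begin
    coeff (a ·ₚ (b ·ₚ p)) n ≈⟨ trans (coeff-· a (b ·ₚ p) n) (*-congˡ (coeff-· b p n)) ⟩
    a * (b * coeff p n)     ≈⟨ *-assoc _ _ _ ⟨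
    (a * b) * coeff p n     ≈⟨ coeff-· (a * b) p n ⟨
    coeff ((a * b) ·ₚ p) n  ∎
    where open ≈-Reasoning

  ·ₚ-comm : ∀ a b p → a ·ₚ (b ·ₚ p) ≈ₚ b ·ₚ (a ·ₚ p)
  ·ₚ-comm a b p =
    ≈ₚ-trans (·ₚ-assoc a b p) (≈ₚ-trans (·ₚ-cong (*-comm a b) ≈ₚ-refl) (≈ₚ-sym (·ₚ-assoc b a p)))

  ·ₚ-identityˡ : ∀ p → 1# ·ₚ p ≈ₚ p
  ·ₚ-identityˡ p = coeffwise λ n → trans (coeff-· 1# p n) (*-identityˡ _)

  ·ₚ-zeroˡ : ∀ {a} p → a ≈ 0# → a ·ₚ p ≈ₚ []
  ·ₚ-zeroˡ {a} p a≈0 = coeffwise λ n → trans (coeff-· a p n) (trans (*-congʳ a≈0) (zeroˡ _))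

  ·ₚ-x* : ∀ a p → a ·ₚ (0# ∷ p) ≈ₚ 0# ∷ (a ·ₚ p)
  ·ₚ-x* a p = ∷-cong (zeroʳ a) ≈ₚ-refl

  x*-distrib-+ₚ : ∀ p q → 0# ∷ (p +ₚ q) ≈ₚ (0# ∷ p) +ₚ (0# ∷ q)
  x*-distrib-+ₚ p q = ∷-cong (sym (+-identityʳ 0#)) ≈ₚ-refl

  x*-zero : 0# ∷ [] ≈ₚ []
  x*-zero = coeffwise λ where
    zero    → refl
    (suc n) → refl

  x*-*ₚ : ∀ p q → (0# ∷ p) *ₚ q ≈ₚ 0# ∷ (p *ₚ q)
  x*-*ₚ p q = +ₚ-cong (·ₚ-zeroˡ q refl) ≈ₚ-refl

  *ₚ-zeroˡ : ∀ {p} q → p ≈ₚ [] → p *ₚ q ≈ₚ []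
  *ₚ-zeroˡ {[]}    q p≈0 = ≈ₚ-refl
  *ₚ-zeroˡ {a ∷ p} q p≈0 =
    ≈ₚ-trans (+ₚ-cong (·ₚ-zeroˡ q (at p≈0 0)) (∷-cong refl (*ₚ-zeroˡ q (∷≈[]⇒≈[] p≈0)))) x*-zero

  *ₚ-zeroʳ : ∀ p → p *ₚ [] ≈ₚ []
  *ₚ-zeroʳ []      = ≈ₚ-refl
  *ₚ-zeroʳ (a ∷ p) = ≈ₚ-trans (∷-cong refl (*ₚ-zeroʳ p)) x*-zero

  *ₚ-congˡ : ∀ p {q q′} → q ≈ₚ q′ → p *ₚ q ≈ₚ p *ₚ q′
  *ₚ-congˡ []      e = ≈ₚ-refl
  *ₚ-congˡ (a ∷ p) e = +ₚ-cong (·ₚ-cong refl e) (∷-cong refl (*ₚ-congˡ p e))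

  *ₚ-congʳ : ∀ {p p′} q → p ≈ₚ p′ → p *ₚ q ≈ₚ p′ *ₚ q
  *ₚ-congʳ {[]}    {p′}     q e = ≈ₚ-sym (*ₚ-zeroˡ q (≈ₚ-sym e))
  *ₚ-congʳ {a ∷ p} {[]}     q e = *ₚ-zeroˡ q e
  *ₚ-congʳ {a ∷ p} {b ∷ p′} q e =
    +ₚ-cong (·ₚ-cong (at e 0) ≈ₚ-refl) (∷-cong refl (*ₚ-congʳ q (∷-congʳ e)))

  *ₚ-distribʳ : ∀ p p′ q → (p +ₚ p′) *ₚ q ≈ₚ p *ₚ q +ₚ p′ *ₚ q
  *ₚ-distribʳ []      p′       q = ≈ₚ-refl
  *ₚ-distribʳ (a ∷ p) []       q = ≈ₚ-sym (+ₚ-identityʳ _)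
  *ₚ-distribʳ (a ∷ p) (b ∷ p′) q = ≈ₚ-trans
    (+ₚ-cong (·ₚ-distribʳ a b q)
             (≈ₚ-trans (∷-cong refl (*ₚ-distribʳ p p′ q)) (x*-distrib-+ₚ (p *ₚ q) (p′ *ₚ q))))
    (+ₚ-interchange (a ·ₚ q) (b ·ₚ q) (0# ∷ (p *ₚ q)) (0# ∷ (p′ *ₚ q)))

  ·ₚ-*ₚ-assoc : ∀ a p q → (a ·ₚ p) *ₚ q ≈ₚ a ·ₚ (p *ₚ q)
  ·ₚ-*ₚ-assoc a []      q = ≈ₚ-refl
  ·ₚ-*ₚ-assoc a (b ∷ p) q = begin
    (a * b) ·ₚ q +ₚ (0# ∷ (a ·ₚ p) *ₚ q)   ≈⟨ +ₚ-cong (≈ₚ-sym (·ₚ-assoc a b q)) (∷-cong refl (·ₚ-*ₚ-assoc a p q)) ⟩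
    a ·ₚ (b ·ₚ q) +ₚ (0# ∷ a ·ₚ (p *ₚ q)) ≈⟨ +ₚ-cong ≈ₚ-refl (≈ₚ-sym (·ₚ-x* a (p *ₚ q))) ⟩
    a ·ₚ (b ·ₚ q) +ₚ a ·ₚ (0# ∷ p *ₚ q)   ≈⟨ ·ₚ-distribˡ a (b ·ₚ q) (0# ∷ (p *ₚ q)) ⟨
    a ·ₚ ((b ∷ p) *ₚ q)                    ∎
    where open ≈ₚ-Reasoning

  *ₚ-·ₚ-comm : ∀ a p q → p *ₚ (a ·ₚ q) ≈ₚ a ·ₚ (p *ₚ q)
  *ₚ-·ₚ-comm a []      q = ≈ₚ-refl
  *ₚ-·ₚ-comm a (b ∷ p) q = begin
    b ·ₚ (a ·ₚ q) +ₚ (0# ∷ p *ₚ (a ·ₚ q)) ≈⟨ +ₚ-cong (·ₚ-comm b a q) (∷-cong refl (*ₚ-·ₚ-comm a p q)) ⟩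
    a ·ₚ (b ·ₚ q) +ₚ (0# ∷ a ·ₚ (p *ₚ q)) ≈⟨ +ₚ-cong ≈ₚ-refl (≈ₚ-sym (·ₚ-x* a (p *ₚ q))) ⟩
    a ·ₚ (b ·ₚ q) +ₚ a ·ₚ (0# ∷ p *ₚ q)   ≈⟨ ·ₚ-distribˡ a (b ·ₚ q) (0# ∷ (p *ₚ q)) ⟨
    a ·ₚ ((b ∷ p) *ₚ q)                    ∎
    where open ≈ₚ-Reasoning

  const-*ₚ : ∀ a p → const a *ₚ p ≈ₚ a ·ₚ p
  const-*ₚ a p = ≈ₚ-trans (+ₚ-cong ≈ₚ-refl x*-zero) (+ₚ-identityʳ (a ·ₚ p))

  *ₚ-const : ∀ p a → p *ₚ const a ≈ₚ a ·ₚ p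
  *ₚ-const []      a = ≈ₚ-refl
  *ₚ-const (b ∷ p) a = ∷-cong (trans (+-identityʳ _) (*-comm b a)) (*ₚ-const p a)

  1ₚ-*ₚ : ∀ p → 1ₚ *ₚ p ≈ₚ p
  1ₚ-*ₚ p = ≈ₚ-trans (const-*ₚ 1# p) (·ₚ-identityˡ p)

  +ₚ-rotate : ∀ p q r → p +ₚ (q +ₚ r) ≈ₚ q +ₚ (p +ₚ r)
  +ₚ-rotate p q r = coeffwise λ n → begin
    coeff (p +ₚ (q +ₚ r)) n             ≈⟨ trans (coeff-+ p (q +ₚ r) n) (+-congˡ (coeff-+ q r n)) ⟩
    coeff p n + (coeff q n + coeff r n) ≈⟨ x∙yz≈y∙xz _ _ _ ⟩
    coeff q n + (coeff p n + coeff r n) ≈⟨ trans (coeff-+ q (p +ₚ r) n) (+-congˡ (coeff-+ p r n)) ⟨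
    coeff (q +ₚ (p +ₚ r)) n             ∎
    where open ≈-Reasoning

  -ₚ-cong : ∀ {p q} → p ≈ₚ q → -ₚ p ≈ₚ -ₚ q
  -ₚ-cong {p} {q} e = coeffwise λ n → trans (coeff-‿ p n) (trans (-‿cong (at e n)) (sym (coeff-‿ q n)))

  p-p≈[] : ∀ p → p -ₚ p ≈ₚ []
  p-p≈[] p = coeffwise λ n → trans (coeff-- p p n) (-‿inverseʳ _)

  p-[p-q]≈q : ∀ p q → p -ₚ (p -ₚ q) ≈ₚ q
  p-[p-q]≈q p q = coeffwise λ n → begin
    coeff (p -ₚ (p -ₚ q)) n                 ≈⟨ trans (coeff-- p (p -ₚ q) n) (+-congˡ (-‿cong (coeff-- p q n))) ⟩
    coeff p n - (coeff p n - coeff q n)     ≈⟨ +-congˡ (sym (⁻¹-∙-comm _ _)) ⟩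
    coeff p n + (- coeff p n - - coeff q n) ≈⟨ +-assoc _ _ _ ⟨
    (coeff p n - coeff p n) - - coeff q n   ≈⟨ +-cong (-‿inverseʳ _) (⁻¹-involutive _) ⟩
    0# + coeff q n                          ≈⟨ +-identityˡ _ ⟩
    coeff q n                               ∎
    where open ≈-Reasoning

  [p+q]-p≈q : ∀ p q → (p +ₚ q) -ₚ p ≈ₚ q
  [p+q]-p≈q p q = coeffwise λ n → begin
    coeff ((p +ₚ q) -ₚ p) n             ≈⟨ trans (coeff-- (p +ₚ q) p n) (+-congʳ (coeff-+ p q n)) ⟩
    (coeff p n + coeff q n) - coeff p n ≈⟨ +-congʳ (+-comm _ _) ⟩
    (coeff q n + coeff p n) - coeff p n ≈⟨ +-assoc _ _ _ ⟩
    coeff q n + (coeff p n - coeff p n) ≈⟨ trans (+-congˡ (-‿inverseʳ _)) (+-identityʳ _) ⟩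
    coeff q n                           ∎
    where open ≈-Reasoning

  *ₚ-∷ : ∀ p a q → p *ₚ (a ∷ q) ≈ₚ a ·ₚ p +ₚ (0# ∷ p *ₚ q)
  *ₚ-∷ []      a q = ≈ₚ-sym x*-zero
  *ₚ-∷ (b ∷ p) a q = ∷-cong (trans (+-identityʳ _) (trans (*-comm b a) (sym (+-identityʳ _))))
    (≈ₚ-trans (+ₚ-cong (≈ₚ-refl {b ·ₚ q}) (*ₚ-∷ p a q))
              (+ₚ-rotate (b ·ₚ q) (a ·ₚ p) (0# ∷ p *ₚ q)))

  record DegreeBelow (k : ℕ) (p : Poly) : Set ℓ where
    constructor degreeBelow
    field vanishes : ∀ m → k ≤ m → coeff p m ≈ 0#
  open DegreeBelow public

  HasDegree : ℕ → Poly → Set ℓ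
  HasDegree k p = ¬ coeff p k ≈ 0# × DegreeBelow (suc k) p

  degreeBelow-length : ∀ p → DegreeBelow (length p) p
  degreeBelow-length p = degreeBelow (vanish p)
    where
    vanish : ∀ p m → length p ≤ m → coeff p m ≈ 0#
    vanish []      m       _         = refl
    vanish (a ∷ p) (suc m) (s≤s l≤m) = vanish p m l≤m

  degreeBelow-mono : ∀ {k k′ p} → k ≤ k′ → DegreeBelow k p → DegreeBelow k′ p
  degreeBelow-mono k≤k′ d = degreeBelow λ m k′≤m → vanishes d m (≤-trans k≤k′ k′≤m)

  degreeBelow-resp : ∀ {k p q} → p ≈ₚ q → DegreeBelow k p → DegreeBelow k q
  degreeBelow-resp p≈q d = degreeBelow λ m k≤m → trans (sym (at p≈q m)) (vanishes d m k≤m)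

  degreeBelow-+ₚ : ∀ {k p q} → DegreeBelow k p → DegreeBelow k q → DegreeBelow k (p +ₚ q)
  degreeBelow-+ₚ {p = p} {q} dp dq = degreeBelow λ m k≤m →
    trans (coeff-+ p q m) (trans (+-cong (vanishes dp m k≤m) (vanishes dq m k≤m)) (+-identityˡ 0#))

  degreeBelow-·ₚ : ∀ a {k p} → DegreeBelow k p → DegreeBelow k (a ·ₚ p)
  degreeBelow-·ₚ a {p = p} d = degreeBelow λ m k≤m →
    trans (coeff-· a p m) (trans (*-congˡ (vanishes d m k≤m)) (zeroʳ a))

  degreeBelow-∷ : ∀ {k a p} → DegreeBelow k p → DegreeBelow (suc k) (a ∷ p)
  degreeBelow-∷ d = degreeBelow λ where (suc m) (s≤s k≤m) → vanishes d m k≤m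

  degreeBelow-0 : ∀ {p} → DegreeBelow 0 p → p ≈ₚ []
  degreeBelow-0 d = coeffwise λ n → vanishes d n z≤n

  degreeBelow-lower : ∀ {k p} → DegreeBelow (suc k) p → coeff p k ≈ 0# → DegreeBelow k p
  degreeBelow-lower {k} {p} d pₖ≈0 = degreeBelow vanish
    where
    vanish : ∀ m → k ≤ m → coeff p m ≈ 0#
    vanish m k≤m with m≤n⇒m<n∨m≡n k≤m
    ... | inj₁ k<m    = vanishes d m k<m
    ... | inj₂ ≡-refl = pₖ≈0

  degreeBelow-cancel : ∀ {k f g} t → DegreeBelow (suc k) f → DegreeBelow (suc k) g →
                       coeff f k ≈ t * coeff g k → DegreeBelow k (f -ₚ t ·ₚ g)
  degreeBelow-cancel {k} {f} {g} t df dg fₖ≈tgₖ = degreeBelow-lower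
    (degreeBelow-+ₚ df (degreeBelow-resp (≈ₚ-sym (-ₚ≈-1·ₚ (t ·ₚ g)))
                                         (degreeBelow-·ₚ (- 1#) (degreeBelow-·ₚ t dg))))
    (begin
      coeff (f -ₚ t ·ₚ g) k          ≈⟨ coeff-- f (t ·ₚ g) k ⟩
      coeff f k - coeff (t ·ₚ g) k   ≈⟨ +-congˡ (-‿cong (trans (coeff-· t g k) (sym fₖ≈tgₖ))) ⟩
      coeff f k - coeff f k          ≈⟨ -‿inverseʳ _ ⟩
      0#                             ∎)
    where open ≈-Reasoning

  shift : ℕ → Poly → Poly
  shift zero    p = p
  shift (suc e) p = 0# ∷ shift e p

  coeff-shift : ∀ e p i → coeff (shift e p) (e +ℕ i) ≈ coeff p i
  coeff-shift zero    p i = refl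
  coeff-shift (suc e) p i = coeff-shift e p i

  degreeBelow-shift : ∀ e {k p} → DegreeBelow k p → DegreeBelow (e +ℕ k) (shift e p)
  degreeBelow-shift zero    d = d
  degreeBelow-shift (suc e) d = degreeBelow-∷ (degreeBelow-shift e d)

  pseudoDivisionStep : ℕ → Poly → ℕ → Poly → Poly
  pseudoDivisionStep k g N f = coeff g k ·ₚ f -ₚ coeff f N ·ₚ shift (N ∸ k) g

  pseudoDivisionStep-degree : ∀ {k g N f} → k ≤ N → DegreeBelow (suc k) g → DegreeBelow (suc N) f →
                      DegreeBelow N (pseudoDivisionStep k g N f)
  pseudoDivisionStep-degree {k} {g} {N} {f} k≤N dg df =
    degreeBelow-cancel (coeff f N) (degreeBelow-·ₚ (coeff g k) df) ds (begin
      coeff (coeff g k ·ₚ f) N ≈⟨ coeff-· (coeff g k) f N ⟩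
      coeff g k * coeff f N    ≈⟨ *-comm _ _ ⟩
      coeff f N * coeff g k    ≈⟨ *-congˡ sₙ≈gₖ ⟨
      coeff f N * coeff s N    ∎)
    where
    open ≈-Reasoning
    e = N ∸ k
    s = shift e g
    e+k≡N : e +ℕ k ≡ N
    e+k≡N = m∸n+n≡m k≤N
    ds : DegreeBelow (suc N) s
    ds = degreeBelow-mono (≤-reflexive (≡-trans (+-suc e k) (cong suc e+k≡N))) (degreeBelow-shift e dg)
    sₙ≈gₖ : coeff s N ≈ coeff g k
    sₙ≈gₖ = subst (λ j → coeff s j ≈ coeff g k) e+k≡N (coeff-shift e g k)

  ∣-+ : ∀ {a x y} → a ∣ x → a ∣ y → a ∣ x + y
  ∣-+ (q , qa≈x) (r , ra≈y) = q + r , trans (distribʳ _ q r) (+-cong qa≈x ra≈y)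

  infix 4 _∣ᶜ_
  record _∣ᶜ_ (a : Carrier) (p : Poly) : Set (c ⊔ ℓ) where
    constructor coeffwise∣
    field ∣coeff : ∀ i → a ∣ coeff p i
  open _∣ᶜ_ public

  ∣ᶜ-∷⁻¹ : ∀ {a x p} → a ∣ᶜ x ∷ p → a ∣ᶜ p
  ∣ᶜ-∷⁻¹ a∣p = coeffwise∣ λ i → ∣coeff a∣p (suc i)

  ∣ᶜ⇒·ₚ : ∀ {a p} → a ∣ᶜ p → ∃ λ q → a ·ₚ q ≈ₚ p
  ∣ᶜ⇒·ₚ {a} {[]}    a∣p = [] , ≈ₚ-refl
  ∣ᶜ⇒·ₚ {a} {x ∷ p} a∣p with ∣coeff a∣p 0 | ∣ᶜ⇒·ₚ (∣ᶜ-∷⁻¹ a∣p)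
  ... | (q , qa≈x) | (r , ar≈p) = q ∷ r , ∷-cong (trans (*-comm a q) qa≈x) ar≈p

  ∣⇒∣ᶜ-·ₚ : ∀ {m a} → m ∣ a → ∀ p → m ∣ᶜ a ·ₚ p
  ∣⇒∣ᶜ-·ₚ {m} {a} m∣a p = coeffwise∣ λ i →
    ∣ʳ-respʳ-≈ (trans (*-comm _ a) (sym (coeff-· a p i))) (x∣ʳy⇒x∣ʳzy (coeff p i) m∣a)

  Multiple : Poly → Pred Poly (c ⊔ ℓ)
  Multiple g f = ∃ λ h → h *ₚ g ≈ₚ f

  ∣ᶜ⇒multiple-const : ∀ {a p} → a ∣ᶜ p → Multiple (const a) p
  ∣ᶜ⇒multiple-const {a} a∣p = proj₁ (∣ᶜ⇒·ₚ a∣p) , ≈ₚ-trans (*ₚ-const _ a) (proj₂ (∣ᶜ⇒·ₚ a∣p))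

  const-unit : ∀ {a} → Multiple (const a) 1ₚ → ∃ λ y → y * a ≈ 1#
  const-unit {a} (u , u·a≈1) =
    coeff u 0 , trans (*-comm _ a) (trans (sym (coeff-· a u 0)) (trans (sym (at (*ₚ-const u a) 0)) (at u·a≈1 0)))

  record IsIdealₚ (J : Pred Poly (c ⊔ ℓ)) : Set (c ⊔ ℓ) where
    field
      resp     : ∀ {p q} → p ≈ₚ q → J p → J q
      []∈      : J []
      +-closed : ∀ {p q} → J p → J q → J (p +ₚ q)
      ·-closed : ∀ a {p} → J p → J (a ·ₚ p)
      x*-closed : ∀ {p} → J p → J (0# ∷ p)

    *-closed : ∀ r {p} → J p → J (r *ₚ p)
    *-closed []      _   = []∈
    *-closed (a ∷ r) p∈J = +-closed (·-closed a p∈J) (x*-closed (*-closed r p∈J))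

    shift-closed : ∀ e {p} → J p → J (shift e p)
    shift-closed zero    p∈J = p∈J
    shift-closed (suc e) p∈J = x*-closed (shift-closed e p∈J)

    neg-closed : ∀ {p} → J p → J (-ₚ p)
    neg-closed p∈J = resp (≈ₚ-sym (-ₚ≈-1·ₚ _)) (·-closed (- 1#) p∈J)

    sub-closed : ∀ {p q} → J p → J q → J (p -ₚ q)
    sub-closed p∈J q∈J = +-closed p∈J (neg-closed q∈J)

    +-cancelˡ-closed : ∀ {p q} → J (p +ₚ q) → J p → J q
    +-cancelˡ-closed {p} {q} p+q∈J p∈J = resp ([p+q]-p≈q p q) (sub-closed p+q∈J p∈J)

    pseudoDivisionStep-closed : ∀ {g f} k N → J g → J f → J (pseudoDivisionStep k g N f)
    pseudoDivisionStep-closed {g} {f} k N g∈J f∈J =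
      sub-closed (·-closed (coeff g k) f∈J) (·-closed (coeff f N) (shift-closed (N ∸ k) g∈J))

    sub-refl : ∀ p → J (p -ₚ p)
    sub-refl p = resp (≈ₚ-sym (p-p≈[] p)) []∈

    sub-trans : ∀ {p q r} → J (p -ₚ q) → J (q -ₚ r) → J (p -ₚ r)
    sub-trans {p} {q} {r} p-q∈J q-r∈J = resp ([p-q]+[q-r]≈p-r p q r) (+-closed p-q∈J q-r∈J)

    ∣ᶜ⇒∈ : ∀ {a p} → J (const a) → a ∣ᶜ p → J p
    ∣ᶜ⇒∈ {a} a∈J a∣p = resp (≈ₚ-trans (*ₚ-const q a) aq≈p) (*-closed q a∈J)
      where
      q = proj₁ (∣ᶜ⇒·ₚ a∣p)
      aq≈p = proj₂ (∣ᶜ⇒·ₚ a∣p)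

  ∣ᶜ-isIdealₚ : ∀ a → IsIdealₚ (a ∣ᶜ_)
  ∣ᶜ-isIdealₚ a = record
    { resp      = λ p≈q a∣p → coeffwise∣ λ i → ∣ʳ-respʳ-≈ (at p≈q i) (∣coeff a∣p i)
    ; []∈       = coeffwise∣ λ _ → a ∣0
    ; +-closed  = λ {p} {q} a∣p a∣q → coeffwise∣ λ i →
        ∣ʳ-respʳ-≈ (sym (coeff-+ p q i)) (∣-+ (∣coeff a∣p i) (∣coeff a∣q i))
    ; ·-closed  = λ b {p} a∣p → coeffwise∣ λ i →
        ∣ʳ-respʳ-≈ (sym (coeff-· b p i)) (x∣ʳy⇒x∣ʳzy b (∣coeff a∣p i))
    ; x*-closed = λ a∣p → coeffwise∣ λ where
        zero    → a ∣0
        (suc i) → ∣coeff a∣p i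
    }

  multiple-isIdealₚ : ∀ g → IsIdealₚ (Multiple g)
  multiple-isIdealₚ g = record
    { resp      = λ { p≈q (h , hg≈p) → h , ≈ₚ-trans hg≈p p≈q }
    ; []∈       = [] , ≈ₚ-refl
    ; +-closed  = λ { (h , hg≈p) (h′ , h′g≈q) →
        h +ₚ h′ , ≈ₚ-trans (*ₚ-distribʳ h h′ g) (+ₚ-cong hg≈p h′g≈q) }
    ; ·-closed  = λ { a (h , hg≈p) → a ·ₚ h , ≈ₚ-trans (·ₚ-*ₚ-assoc a h g) (·ₚ-cong refl hg≈p) }
    ; x*-closed = λ { (h , hg≈p) → 0# ∷ h , ≈ₚ-trans (x*-*ₚ h g) (∷-cong refl hg≈p) }
    }

  Generated₂ : Poly → Poly → Pred Poly (c ⊔ ℓ)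
  Generated₂ f₁ f₂ h = ∃₂ λ g₁ g₂ → g₁ *ₚ f₁ +ₚ g₂ *ₚ f₂ ≈ₚ h

  generated₂-isIdealₚ : ∀ f₁ f₂ → IsIdealₚ (Generated₂ f₁ f₂)
  generated₂-isIdealₚ f₁ f₂ = record
    { resp      = λ { p≈q (g₁ , g₂ , e) → g₁ , g₂ , ≈ₚ-trans e p≈q }
    ; []∈       = [] , [] , ≈ₚ-refl
    ; +-closed  = λ { (g₁ , g₂ , e) (h₁ , h₂ , e′) → g₁ +ₚ h₁ , g₂ +ₚ h₂ ,
        ≈ₚ-trans (+ₚ-cong (*ₚ-distribʳ g₁ h₁ f₁) (*ₚ-distribʳ g₂ h₂ f₂))
          (≈ₚ-trans (+ₚ-interchange (g₁ *ₚ f₁) (h₁ *ₚ f₁) (g₂ *ₚ f₂) (h₂ *ₚ f₂)) (+ₚ-cong e e′)) }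
    ; ·-closed  = λ { a (g₁ , g₂ , e) → a ·ₚ g₁ , a ·ₚ g₂ ,
        ≈ₚ-trans (+ₚ-cong (·ₚ-*ₚ-assoc a g₁ f₁) (·ₚ-*ₚ-assoc a g₂ f₂))
          (≈ₚ-trans (≈ₚ-sym (·ₚ-distribˡ a (g₁ *ₚ f₁) (g₂ *ₚ f₂))) (·ₚ-cong refl e)) }
    ; x*-closed = λ { (g₁ , g₂ , e) → 0# ∷ g₁ , 0# ∷ g₂ ,
        ≈ₚ-trans (+ₚ-cong (x*-*ₚ g₁ f₁) (x*-*ₚ g₂ f₂))
          (≈ₚ-trans (≈ₚ-sym (x*-distrib-+ₚ (g₁ *ₚ f₁) (g₂ *ₚ f₂))) (∷-cong refl e)) }
    }

  generated₂-left : ∀ f₁ f₂ → Generated₂ f₁ f₂ f₁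
  generated₂-left f₁ f₂ = 1ₚ , [] , ≈ₚ-trans (+ₚ-identityʳ _) (1ₚ-*ₚ f₁)

  generated₂-right : ∀ f₁ f₂ → Generated₂ f₁ f₂ f₂
  generated₂-right f₁ f₂ = [] , 1ₚ , 1ₚ-*ₚ f₂

  dot : Poly → Poly → Carrier
  dot []      q = 0#
  dot (a ∷ v) q = a * coeff q 0 + dot v (drop 1 q)

  coeff-drop1 : ∀ q i → coeff (drop 1 q) i ≈ coeff q (suc i)
  coeff-drop1 []      i = refl
  coeff-drop1 (b ∷ q) i = refl

  dot-+ₚˡ : ∀ v w q → dot (v +ₚ w) q ≈ dot v q + dot w q
  dot-+ₚˡ []      w       q = sym (+-identityˡ _)
  dot-+ₚˡ (a ∷ v) []      q = sym (+-identityʳ _)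
  dot-+ₚˡ (a ∷ v) (b ∷ w) q = trans (+-cong (distribʳ _ a b) (dot-+ₚˡ v w (drop 1 q))) (interchange _ _ _ _)

  dot-·ₚˡ : ∀ r v q → dot (r ·ₚ v) q ≈ r * dot v q
  dot-·ₚˡ r []      q = sym (zeroʳ r)
  dot-·ₚˡ r (a ∷ v) q = trans (+-cong (*-assoc r a _) (dot-·ₚˡ r v (drop 1 q))) (sym (distribˡ r _ _))

  dot-congʳ : ∀ v {q q′} → q ≈ₚ q′ → dot v q ≈ dot v q′
  dot-congʳ []      e = refl
  dot-congʳ (a ∷ v) {q} {q′} e = +-cong (*-congˡ (at e 0))
    (dot-congʳ v (coeffwise λ i → trans (coeff-drop1 q i) (trans (at e (suc i)) (sym (coeff-drop1 q′ i)))))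

  dot-·ₚʳ : ∀ v d q → dot v (d ·ₚ q) ≈ d * dot v q
  dot-·ₚʳ []      d q       = sym (zeroʳ d)
  dot-·ₚʳ (a ∷ v) d q       = begin
    a * coeff (d ·ₚ q) 0 + dot v (drop 1 (d ·ₚ q)) ≈⟨ +-cong (*-congˡ (coeff-· d q 0)) (dot-congʳ v (drop1-·ₚ q)) ⟩
    a * (d * coeff q 0) + dot v (d ·ₚ drop 1 q)    ≈⟨ +-cong (x*[y*z]≈y*[x*z] a d _) (dot-·ₚʳ v d (drop 1 q)) ⟩
    d * (a * coeff q 0) + d * dot v (drop 1 q)     ≈⟨ distribˡ d _ _ ⟨
    d * (a * coeff q 0 + dot v (drop 1 q))         ∎
    where
    open ≈-Reasoning
    drop1-·ₚ : ∀ q → drop 1 (d ·ₚ q) ≈ₚ d ·ₚ drop 1 q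
    drop1-·ₚ []      = ≈ₚ-refl
    drop1-·ₚ (b ∷ q) = ≈ₚ-refl

  dot-shift : ∀ i q → dot (shift i 1ₚ) q ≈ coeff q i
  dot-shift zero    q = trans (+-identityʳ _) (*-identityˡ _)
  dot-shift (suc i) q = trans (+-cong (zeroˡ _) (dot-shift i (drop 1 q))) (trans (+-identityˡ _) (coeff-drop1 q i))

  CoefficientIdeal : Poly → Pred Carrier (c ⊔ ℓ)
  CoefficientIdeal g x = ∃ λ v → dot v g ≈ x

  coefficientIdeal-isIdeal : ∀ g → IsIdeal (CoefficientIdeal g)
  coefficientIdeal-isIdeal g = record
    { resp     = λ { x≈y (v , e) → v , trans e x≈y }
    ; zero∈    = [] , refl
    ; +-closed = λ { (v , e) (w , e′) → v +ₚ w , trans (dot-+ₚˡ v w g) (+-cong e e′) }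
    ; *-closed = λ { r (v , e) → r ·ₚ v , trans (dot-·ₚˡ r v g) (*-congˡ e) }
    }

  coeff∈coefficientIdeal : ∀ g i → CoefficientIdeal g (coeff g i)
  coeff∈coefficientIdeal g i = shift i 1ₚ , dot-shift i g

  Primitive : Poly → Set (c ⊔ ℓ)
  Primitive g = ∃ λ v → dot v g ≈ 1#

  -- Gauss's lemma in McCoy's form: for primitive g, a common divisor of the coefficients of
  -- h *ₚ g divides those of h.
  module GaussLemma {g v} (vg≈1 : dot v g ≈ 1#) (m : Carrier) where
    open IsIdealₚ (∣ᶜ-isIdealₚ m)

    dot-∣ : ∀ w q x → (∀ i → m ∣ coeff q i * x) → m ∣ dot w q * x
    dot-∣ []      q x _   = ∣ʳ-respʳ-≈ (sym (zeroˡ x)) (m ∣0)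
    dot-∣ (a ∷ w) q x m∣q = ∣ʳ-respʳ-≈ (sym (trans (distribʳ x _ _) (+-congʳ (*-assoc a _ x))))
      (∣-+ (x∣ʳy⇒x∣ʳzy a (m∣q 0))
           (dot-∣ w (drop 1 q) x (λ i → ∣ʳ-respʳ-≈ (*-congʳ (sym (coeff-drop1 q i))) (m∣q (suc i)))))

    ∣ᶜ-from-coefficients : ∀ {k} → (∀ i → m ∣ᶜ coeff g i ·ₚ k) → m ∣ᶜ k
    ∣ᶜ-from-coefficients {k} m∣gᵢk = coeffwise∣ λ j → ∣ʳ-respʳ-≈ (trans (*-congʳ vg≈1) (*-identityˡ _))
      (dot-∣ v g (coeff k j) λ i → ∣ʳ-respʳ-≈ (coeff-· (coeff g i) k j) (∣coeff (m∣gᵢk i) j))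

    spread : ∀ k → (∀ c → m ∣ c * coeff k 0 → m ∣ᶜ c ·ₚ k) →
             ∀ s → m ∣ᶜ k *ₚ s → ∀ i → m ∣ᶜ coeff s i ·ₚ k
    spread k head⇒all []      _     i = resp (≈ₚ-sym (·ₚ-zeroˡ k refl)) []∈
    spread k head⇒all (c ∷ s) m∣ks i = go i
      where
      m∣ck+ks : m ∣ᶜ c ·ₚ k +ₚ (0# ∷ k *ₚ s)
      m∣ck+ks = resp (*ₚ-∷ k c s) m∣ks
      m∣ck : m ∣ᶜ c ·ₚ k
      m∣ck = head⇒all c (∣ʳ-respʳ-≈ (trans (coeff-+ (c ·ₚ k) (0# ∷ k *ₚ s) 0)
                                          (trans (+-identityʳ _) (coeff-· c k 0)))
                                   (∣coeff m∣ck+ks 0))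
      m∣ks′ : m ∣ᶜ k *ₚ s
      m∣ks′ = ∣ᶜ-∷⁻¹ (+-cancelˡ-closed {c ·ₚ k} m∣ck+ks m∣ck)
      go : ∀ i → m ∣ᶜ coeff (c ∷ s) i ·ₚ k
      go zero    = m∣ck
      go (suc i) = spread k head⇒all s m∣ks′ i

    -- Generalised over the scalar a so that the induction hypothesis applies to (c * a) ·ₚ h.
    cancel-scaled : ∀ h a → m ∣ᶜ (a ·ₚ h) *ₚ g → m ∣ᶜ a ·ₚ h
    cancel-scaled []      a _      = []∈
    cancel-scaled (b ∷ h) a m∣ahg = ∣ᶜ-from-coefficients (spread (a ·ₚ (b ∷ h)) head⇒all g m∣ahg)
      where
      head⇒all : ∀ c → m ∣ c * (a * b) → m ∣ᶜ c ·ₚ (a ·ₚ (b ∷ h))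
      head⇒all c m∣cab = coeffwise∣ λ where
          zero    → m∣cab
          (suc i) → ∣coeff (resp (≈ₚ-sym (·ₚ-assoc c a h)) (cancel-scaled h (c * a) m∣caₕg)) i
        where
        m∣cahg : m ∣ᶜ (c * (a * b)) ·ₚ g +ₚ (0# ∷ (c ·ₚ (a ·ₚ h)) *ₚ g)
        m∣cahg = resp (≈ₚ-sym (·ₚ-*ₚ-assoc c (a ·ₚ (b ∷ h)) g)) (·-closed c m∣ahg)
        m∣caₕg : m ∣ᶜ ((c * a) ·ₚ h) *ₚ g
        m∣caₕg = resp (*ₚ-congʳ g (·ₚ-assoc c a h))
          (∣ᶜ-∷⁻¹ (+-cancelˡ-closed {(c * (a * b)) ·ₚ g} m∣cahg (∣⇒∣ᶜ-·ₚ m∣cab g)))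

    primitive-∣ᶜ-cancel : ∀ {h} → m ∣ᶜ h *ₚ g → m ∣ᶜ h
    primitive-∣ᶜ-cancel {h} m∣hg = resp (·ₚ-identityˡ h)
      (cancel-scaled h 1# (resp (*ₚ-congʳ g (≈ₚ-sym (·ₚ-identityˡ h))) m∣hg))


  polysOver : ℕ → List Carrier → List Poly
  polysOver zero    R = [] ∷ []
  polysOver (suc n) R = cartesianProductWith _∷_ R (polysOver n R)

  polysOver-cover : ∀ {a R} → (∀ x → Any (λ y → a ∣ x - y) R) →
                    ∀ n {r} → DegreeBelow n r → Any (λ q → a ∣ᶜ r -ₚ q) (polysOver n R)
  polysOver-cover {a} cover zero    {r} dr =
    here (D.resp (≈ₚ-sym (≈ₚ-trans (+ₚ-identityʳ r) (degreeBelow-0 dr))) D.[]∈)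
    where module D = IsIdealₚ (∣ᶜ-isIdealₚ a)
  polysOver-cover {a} cover (suc n) {r} dr =
    cartesianProductWith⁺ _∷_ cons (cover (coeff r 0)) (polysOver-cover cover n dr′)
    where
    dr′ : DegreeBelow n (drop 1 r)
    dr′ = degreeBelow λ m n≤m → trans (coeff-drop1 r m) (vanishes dr (suc m) (s≤s n≤m))
    cons : ∀ {y q} → a ∣ coeff r 0 - y → a ∣ᶜ drop 1 r -ₚ q → a ∣ᶜ r -ₚ (y ∷ q)
    cons {y} {q} a∣r₀-y a∣r′-q = coeffwise∣ λ where
      zero    → ∣ʳ-respʳ-≈ (sym (coeff-- r (y ∷ q) 0)) a∣r₀-y
      (suc i) → ∣ʳ-respʳ-≈ (trans (coeff-- (drop 1 r) q i)
                                  (trans (+-congʳ (coeff-drop1 r i)) (sym (coeff-- r (y ∷ q) (suc i)))))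
                           (∣coeff a∣r′-q i)

  module MonicReduction {J : Pred Poly (c ⊔ ℓ)} (isJ : IsIdealₚ J) {h n}
                        (h∈J : J h) (hₙ≈1 : coeff h n ≈ 1#) (dh : DegreeBelow (suc n) h) where
    open IsIdealₚ isJ

    reduce : ∀ N p → DegreeBelow N p → ∃ λ r → DegreeBelow n r × J (p -ₚ r)
    reduce zero    p dp = p , degreeBelow-mono z≤n dp , sub-refl p
    reduce (suc N) p dp with suc N ≤? n
    ... | yes N<n = p , degreeBelow-mono N<n dp , sub-refl p
    ... | no  N≮n = r , dr , sub-trans {p} {p′} p-p′∈J p′-r∈J
      where
      open ≈ₚ-Reasoning
      xs = coeff p N ·ₚ shift (N ∸ n) h
      p′ = pseudoDivisionStep n h N p
      remainder = reduce N p′ (pseudoDivisionStep-degree (s≤s⁻¹ (≰⇒> N≮n)) dh dp)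
      r = proj₁ remainder
      dr = proj₁ (proj₂ remainder)
      p′-r∈J = proj₂ (proj₂ remainder)
      hₙ·p≈p : coeff h n ·ₚ p ≈ₚ p
      hₙ·p≈p = ≈ₚ-trans (·ₚ-cong hₙ≈1 ≈ₚ-refl) (·ₚ-identityˡ p)
      p-p′≈xs : p -ₚ p′ ≈ₚ xs
      p-p′≈xs = begin
        p -ₚ (coeff h n ·ₚ p -ₚ xs) ≈⟨ +ₚ-cong (≈ₚ-refl {p}) (-ₚ-cong (+ₚ-cong hₙ·p≈p (≈ₚ-refl { -ₚ xs}))) ⟩
        p -ₚ (p -ₚ xs)              ≈⟨ p-[p-q]≈q p xs ⟩
        xs                          ∎
      p-p′∈J : J (p -ₚ p′)
      p-p′∈J = resp (≈ₚ-sym p-p′≈xs) (·-closed (coeff p N) (shift-closed (N ∸ n) h∈J))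

  finite-quotient : ∀ {J : Pred Poly (c ⊔ ℓ)} → IsIdealₚ J → ∀ {a h} → J (const a) → Monic h → J h →
                    FiniteQuotient a → ∃ λ reps → ∀ p → Any (λ q → J (p -ₚ q)) reps
  finite-quotient isJ {a} a∈J (n , hₙ≈1 , h-vanishes) h∈J (R , cover) = polysOver n R , λ p →
    let r , dr , p-r∈J = reduce (length p) p (degreeBelow-length p)
    in Any.map (λ {q} a∣r-q → sub-trans {p} {r} {q} p-r∈J (∣ᶜ⇒∈ a∈J a∣r-q)) (polysOver-cover cover n dr)
    where
    open IsIdealₚ isJ
    open MonicReduction isJ h∈J hₙ≈1 (degreeBelow h-vanishes)

module PrincipalIdealDomain {c ℓ : Level} (E : CommutativeRing c ℓ) (pid : Ring.IsPID E) where
  open Polynomials E public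
  open IsPID pid using (principal; isIntegralDomain)
  open IsIntegralDomain isIntegralDomain public
  open RingProperties ring using (x[y-z]≈xy-xz)
  open import Algebra.Definitions.RawMagma *-rawMagma using (_,_; _∣ʳ_)
  open _∣ʳ_ using (quotient; equality)
  open import Algebra.Properties.Group +-group using (x∙y⁻¹≈ε⇒x≈y)
  open CommutativeSemigroupProperties *-commutativeSemigroup using () renaming (x∙yz≈y∙xz to x*[y*z]≈y*[x*z])
  private module ≈-Reasoning = SetoidReasoning setoid

  *-cancelˡ : ∀ {m x y} → ¬ m ≈ 0# → m * x ≈ m * y → x ≈ y
  *-cancelˡ {m} {x} {y} m≉0 mx≈my
    with noZeroDivisors (trans (x[y-z]≈xy-xz m x y) (trans (+-congʳ mx≈my) (-‿inverseʳ _)))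
  ... | inj₁ m≈0   = ⊥-elim (m≉0 m≈0)
  ... | inj₂ x-y≈0 = x∙y⁻¹≈ε⇒x≈y x y x-y≈0

  ·ₚ-cancelˡ : ∀ {m p q} → ¬ m ≈ 0# → m ·ₚ p ≈ₚ m ·ₚ q → p ≈ₚ q
  ·ₚ-cancelˡ {m} {p} {q} m≉0 mp≈mq = coeffwise λ n →
    *-cancelˡ m≉0 (trans (sym (coeff-· m p n)) (trans (at mp≈mq n) (coeff-· m q n)))

  *-cancelˡ-∣ : ∀ {m x y} → ¬ m ≈ 0# → m * x ∣ m * y → x ∣ y
  *-cancelˡ-∣ {m} {x} {y} m≉0 (q , qmx≈my) =
    q , *-cancelˡ m≉0 (trans (sym (x*[y*z]≈y*[x*z] q m x)) qmx≈my)

  excluded-middle : (P : Set (c ⊔ ℓ)) → Dec P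
  excluded-middle P with principal (λ x → P ⊎ x ≈ 0#) isIdeal
    where
    isIdeal : IsIdeal (λ x → P ⊎ x ≈ 0#)
    isIdeal = record
      { resp     = λ { _ (inj₁ p) → inj₁ p ; x≈y (inj₂ x≈0) → inj₂ (trans (sym x≈y) x≈0) }
      ; zero∈    = inj₂ refl
      ; +-closed = λ { (inj₁ p) _ → inj₁ p ; (inj₂ _) (inj₁ p) → inj₁ p
                     ; (inj₂ x≈0) (inj₂ y≈0) → inj₂ (trans (+-cong x≈0 y≈0) (+-identityˡ 0#)) }
      ; *-closed = λ { r (inj₁ p) → inj₁ p ; r (inj₂ x≈0) → inj₂ (trans (*-congˡ x≈0) (zeroʳ r)) }
      }
  ... | d , generates with proj₂ (generates d) ∣ʳ-refl
  ...   | inj₁ p   = yes p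
  ...   | inj₂ d≈0 = no λ p → nontrivial (0∣x⇒x≈0 (∣ʳ-respˡ-≈ d≈0 (proj₁ (generates 1#) (inj₁ p))))

  ≈0? : ∀ x → Dec (x ≈ 0#)
  ≈0? x = map′ lower lift (excluded-middle (Lift c (x ≈ 0#)))

  ≈[]⊎hasDegree : ∀ p → p ≈ₚ [] ⊎ ∃ λ k → HasDegree k p
  ≈[]⊎hasDegree []      = inj₁ ≈ₚ-refl
  ≈[]⊎hasDegree (a ∷ p) with ≈[]⊎hasDegree p
  ... | inj₂ (k , pₖ≉0 , dp) = inj₂ (suc k , pₖ≉0 , degreeBelow-∷ dp)
  ... | inj₁ p≈[] with ≈0? a
  ...   | yes a≈0 = inj₁ (≈ₚ-trans (∷-cong a≈0 p≈[]) x*-zero)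
  ...   | no a≉0  = inj₂ (0 , a≉0 , degreeBelow λ where (suc m) _ → at p≈[] m)

  LeastDegreeElement : Pred Poly (c ⊔ ℓ) → Set (c ⊔ ℓ)
  LeastDegreeElement J = ∃₂ λ k₀ g → J g × HasDegree k₀ g × (∀ {f} → J f → DegreeBelow k₀ f → f ≈ₚ [])

  leastDegreeElement : ∀ {J : Pred Poly (c ⊔ ℓ)} {k f} → J f → HasDegree k f → LeastDegreeElement J
  leastDegreeElement {J} {k} {f} f∈J deg = <-rec Least step k (f , f∈J , deg)
    where
    Least : ℕ → Set (c ⊔ ℓ)
    Least k = (∃ λ f → J f × HasDegree k f) → LeastDegreeElement J
    step : ∀ k → (∀ {j} → j < k → Least j) → Least k
    step k rec (f , f∈J , deg) with excluded-middle (∃ λ j → j < k × ∃ λ f → J f × HasDegree j f)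
    ... | yes (j , j<k , lower) = rec j<k lower
    ... | no none = k , f , f∈J , deg , vanish
      where
      vanish : ∀ {h} → J h → DegreeBelow k h → h ≈ₚ []
      vanish {h} h∈J dh with ≈[]⊎hasDegree h
      ... | inj₁ h≈[] = h≈[]
      ... | inj₂ (j , hⱼ≉0 , dh′) with j <? k
      ...   | yes j<k = ⊥-elim (none (j , j<k , h , h∈J , hⱼ≉0 , dh′))
      ...   | no j≮k  = ⊥-elim (hⱼ≉0 (vanishes dh j (≮⇒≥ j≮k)))

  primitive-factorisation : ∀ {k g} → HasDegree k g →
                            ∃₂ λ d g′ → ¬ d ≈ 0# × d ·ₚ g′ ≈ₚ g × Primitive g′
  primitive-factorisation {k} {g} (gₖ≉0 , _) = d , g′ , d≉0 , dg′≈g , v , vg′≈1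
    where
    open ≈-Reasoning
    generator = principal (CoefficientIdeal g) (coefficientIdeal-isIdeal g)
    d = proj₁ generator
    d∣g : d ∣ᶜ g
    d∣g = coeffwise∣ λ i → proj₁ (proj₂ generator (coeff g i)) (coeff∈coefficientIdeal g i)
    d≉0 = x∣y∧y≉0⇒x≉0 (∣coeff d∣g k) gₖ≉0
    g′ = proj₁ (∣ᶜ⇒·ₚ d∣g)
    dg′≈g = proj₂ (∣ᶜ⇒·ₚ d∣g)
    d∈ideal = proj₂ (proj₂ generator d) ∣ʳ-refl
    v = proj₁ d∈ideal
    vg′≈1 : dot v g′ ≈ 1#
    vg′≈1 = *-cancelˡ d≉0 (begin
      d * dot v g′      ≈⟨ dot-·ₚʳ v d g′ ⟨
      dot v (d ·ₚ g′)   ≈⟨ dot-congʳ v dg′≈g ⟩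
      dot v g           ≈⟨ proj₂ d∈ideal ⟩
      d                 ≈⟨ *-identityʳ d ⟨
      d * 1#            ∎)

  multiple-·ₚ-cancel : ∀ {g a f} → Primitive g → ¬ a ≈ 0# → Multiple g (a ·ₚ f) → Multiple g f
  multiple-·ₚ-cancel {g} {a} {f} (v , vg≈1) a≉0 (h , hg≈af) = h′ , ·ₚ-cancelˡ a≉0 (begin
      a ·ₚ (h′ *ₚ g) ≈⟨ ·ₚ-*ₚ-assoc a h′ g ⟨
      (a ·ₚ h′) *ₚ g ≈⟨ *ₚ-congʳ g ah′≈h ⟩
      h *ₚ g         ≈⟨ hg≈af ⟩
      a ·ₚ f         ∎)
    where
    open ≈ₚ-Reasoning
    a∣h : a ∣ᶜ h
    a∣h = GaussLemma.primitive-∣ᶜ-cancel {g} {v} vg≈1 a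
            (IsIdealₚ.resp (∣ᶜ-isIdealₚ a) (≈ₚ-sym hg≈af) (∣⇒∣ᶜ-·ₚ ∣ʳ-refl f))
    h′ = proj₁ (∣ᶜ⇒·ₚ a∣h)
    ah′≈h = proj₂ (∣ᶜ⇒·ₚ a∣h)

  module LeastDegree {J : Pred Poly (c ⊔ ℓ)} (isJ : IsIdealₚ J) {k₀ g} (g∈J : J g) (deg : HasDegree k₀ g)
                        (minimal : ∀ {f} → J f → DegreeBelow k₀ f → f ≈ₚ []) where
    open IsIdealₚ isJ using (pseudoDivisionStep-closed)

    private
      factorisation = primitive-factorisation deg

    content : Carrier
    content = proj₁ factorisation

    primitivePart : Poly
    primitivePart = proj₁ (proj₂ factorisation)

    content≉0 : ¬ content ≈ 0#
    content≉0 = proj₁ (proj₂ (proj₂ factorisation))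

    content·primitivePart≈g : content ·ₚ primitivePart ≈ₚ g
    content·primitivePart≈g = proj₁ (proj₂ (proj₂ (proj₂ factorisation)))

    primitivePart-primitive : Primitive primitivePart
    primitivePart-primitive = proj₂ (proj₂ (proj₂ (proj₂ factorisation)))

    private
      module M = IsIdealₚ (multiple-isIdealₚ primitivePart)

    primitivePart∣g : Multiple primitivePart g
    primitivePart∣g = const content , ≈ₚ-trans (const-*ₚ content primitivePart) content·primitivePart≈g

    primitivePart∣J : ∀ {f} → J f → Multiple primitivePart f
    primitivePart∣J {f} f∈J = go (length f) f∈J (degreeBelow-length f)
      where
      go : ∀ N {f} → J f → DegreeBelow N f → Multiple primitivePart f
      go zero    f∈J df = M.resp (≈ₚ-sym (degreeBelow-0 df)) M.[]∈
      go (suc N) {f} f∈J df with suc N ≤? k₀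
      ... | yes N<k₀ = M.resp (≈ₚ-sym (minimal f∈J (degreeBelow-mono N<k₀ df))) M.[]∈
      ... | no  N≮k₀ = multiple-·ₚ-cancel primitivePart-primitive (proj₁ deg)
              (M.resp (p-q+q≈p (coeff g k₀ ·ₚ f) (coeff f N ·ₚ shift (N ∸ k₀) g))
                (M.+-closed (go N (pseudoDivisionStep-closed k₀ N g∈J f∈J)
                                  (pseudoDivisionStep-degree k₀≤N (proj₂ deg) df))
                            (M.·-closed (coeff f N) (M.shift-closed (N ∸ k₀) primitivePart∣g))))
        where
        k₀≤N : k₀ ≤ N
        k₀≤N = s≤s⁻¹ (≰⇒> N≮k₀)

  nonzero-constant : ∀ {J : Pred Poly (c ⊔ ℓ)} → IsIdealₚ J →
                     (∀ g → (∀ {f} → J f → Multiple g f) → Multiple g 1ₚ) →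
                     ∃ λ d → ¬ d ≈ 0# × J (const d)
  nonzero-constant {J} isJ common⇒unit with excluded-middle (∃₂ λ k f → J f × HasDegree k f)
  ... | no nothing-nonzero =
    ⊥-elim (nontrivial (at (≈ₚ-trans (≈ₚ-sym (proj₂ []-unit)) (*ₚ-zeroʳ (proj₁ []-unit))) 0))
    where
    []∣J : ∀ {f} → J f → Multiple [] f
    []∣J {f} f∈J with ≈[]⊎hasDegree f
    ... | inj₁ f≈[]       = [] , ≈ₚ-sym f≈[]
    ... | inj₂ (k , deg) = ⊥-elim (nothing-nonzero (k , f , f∈J , deg))
    []-unit = common⇒unit [] []∣J
  ... | yes (k , f , f∈J , deg) with leastDegreeElement f∈J deg
  ...   | k₀ , g , g∈J , deg₀ , minimal = content , content≉0 , resp u*g≈const (*-closed u g∈J)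
    where
    open IsIdealₚ isJ
    open LeastDegree isJ g∈J deg₀ minimal
    open ≈ₚ-Reasoning
    unit = common⇒unit primitivePart primitivePart∣J
    u = proj₁ unit
    u*g≈const : u *ₚ g ≈ₚ const content
    u*g≈const = begin
      u *ₚ g                            ≈⟨ *ₚ-congˡ u content·primitivePart≈g ⟨
      u *ₚ (content ·ₚ primitivePart)   ≈⟨ *ₚ-·ₚ-comm content u primitivePart ⟩
      content ·ₚ (u *ₚ primitivePart)   ≈⟨ ·ₚ-cong refl (proj₂ unit) ⟩
      content ·ₚ 1ₚ                     ≈⟨ ∷-cong (*-identityʳ content) ≈ₚ-refl ⟩
      const content                     ∎

  module LeadingCoefficients {J : Pred Poly (c ⊔ ℓ)} (isJ : IsIdealₚ J)
                             {a} (a≉0 : ¬ a ≈ 0#) (a∈J : J (const a)) where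
    open IsIdealₚ isJ

    Leading : ℕ → Pred Carrier (c ⊔ ℓ)
    Leading k x = ∃ λ f → J f × DegreeBelow (suc k) f × coeff f k ≈ x

    leading-isIdeal : ∀ k → IsIdeal (Leading k)
    leading-isIdeal k = record
      { resp     = λ { x≈y (f , f∈J , df , fₖ≈x) → f , f∈J , df , trans fₖ≈x x≈y }
      ; zero∈    = [] , []∈ , degreeBelow (λ _ _ → refl) , refl
      ; +-closed = λ { (f , f∈J , df , fₖ≈x) (f′ , f′∈J , df′ , f′ₖ≈y) →
          f +ₚ f′ , +-closed f∈J f′∈J , degreeBelow-+ₚ df df′ , trans (coeff-+ f f′ k) (+-cong fₖ≈x f′ₖ≈y) }
      ; *-closed = λ { r (f , f∈J , df , fₖ≈x) →
          r ·ₚ f , ·-closed r f∈J , degreeBelow-·ₚ r df , trans (coeff-· r f k) (*-congˡ fₖ≈x) }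
      }

    private
      generator : ∀ k → IsPrincipal (Leading k)
      generator k = principal (Leading k) (leading-isIdeal k)

    lead : ℕ → Carrier
    lead k = proj₁ (generator k)

    lead∣ : ∀ {k x} → Leading k x → lead k ∣ x
    lead∣ {k} {x} = proj₁ (proj₂ (generator k) x)

    private
      lead-leading : ∀ k → Leading k (lead k)
      lead-leading k = proj₂ (proj₂ (generator k) (lead k)) ∣ʳ-refl

    leader : ℕ → Poly
    leader k = proj₁ (lead-leading k)

    leader∈J : ∀ k → J (leader k)
    leader∈J k = proj₁ (proj₂ (lead-leading k))

    leader-degree : ∀ k → DegreeBelow (suc k) (leader k)
    leader-degree k = proj₁ (proj₂ (proj₂ (lead-leading k)))

    leader-lead : ∀ k → coeff (leader k) k ≈ lead k
    leader-lead k = proj₂ (proj₂ (proj₂ (lead-leading k)))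

    lead-suc∣lead : ∀ k → lead (suc k) ∣ lead k
    lead-suc∣lead k = lead∣ (0# ∷ leader k , x*-closed (leader∈J k) , degreeBelow-∷ (leader-degree k) , leader-lead k)

    a-leading : ∀ k → Leading k a
    a-leading k = shift k (const a) , shift-closed k a∈J , monomial k
      where
      monomial : ∀ k → DegreeBelow (suc k) (shift k (const a)) × coeff (shift k (const a)) k ≈ a
      monomial zero    = degreeBelow (λ where (suc m) _ → refl) , refl
      monomial (suc k) = degreeBelow-∷ (proj₁ (monomial k)) , proj₂ (monomial k)

    lead≉0 : ∀ k → ¬ lead k ≈ 0#
    lead≉0 k = x∣y∧y≉0⇒x≉0 (lead∣ (a-leading k)) a≉0

    -- With m · lead (k + 1) ≈ lead k, the element (0# ∷ leader k) -ₚ m ·ₚ leader (k + 1) of J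
    -- has degree ≤ k, so lead k divides the coefficients of m ·ₚ leader (k + 1).
    lead∣ᶜleader : ∀ k → (∀ {f} → J f → DegreeBelow (suc k) f → lead k ∣ᶜ f) →
                   lead (suc k) ∣ᶜ leader (suc k)
    lead∣ᶜleader k lead∣ᶜ = coeffwise∣ λ i →
      *-cancelˡ-∣ m≉0 (∣ʳ-respˡ-≈ (sym m·lead≈lead)
                                  (∣ʳ-respʳ-≈ (coeff-· m (leader (suc k)) i) (∣coeff lead∣ᶜm·leader i)))
      where
      module D = IsIdealₚ (∣ᶜ-isIdealₚ (lead k))
      m = quotient (lead-suc∣lead k)
      m·lead≈lead : m * lead (suc k) ≈ lead k
      m·lead≈lead = equality (lead-suc∣lead k)
      m≉0 : ¬ m ≈ 0#
      m≉0 m≈0 = lead≉0 k (trans (sym m·lead≈lead) (trans (*-congʳ m≈0) (zeroˡ _)))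
      h = (0# ∷ leader k) -ₚ m ·ₚ leader (suc k)
      dh : DegreeBelow (suc k) h
      dh = degreeBelow-cancel m (degreeBelow-∷ (leader-degree k)) (leader-degree (suc k))
             (trans (leader-lead k) (trans (sym m·lead≈lead) (*-congˡ (sym (leader-lead (suc k))))))
      lead∣ᶜm·leader : lead k ∣ᶜ m ·ₚ leader (suc k)
      lead∣ᶜm·leader = D.resp (p-[p-q]≈q (0# ∷ leader k) (m ·ₚ leader (suc k)))
        (D.sub-closed (D.x*-closed (lead∣ᶜ (leader∈J k) (leader-degree k)))
                      (lead∣ᶜ (sub-closed (x*-closed (leader∈J k)) (·-closed m (leader∈J (suc k)))) dh))

    lead∣ᶜ : ∀ k {f} → J f → DegreeBelow (suc k) f → lead k ∣ᶜ f
    lead∣ᶜ zero {f} f∈J df = coeffwise∣ λ where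
      zero    → lead∣ (f , f∈J , df , refl)
      (suc i) → ∣ʳ-respʳ-≈ (sym (vanishes df (suc i) (s≤s z≤n))) (lead 0 ∣0)
    lead∣ᶜ (suc k) {f} f∈J df = D.resp (p-q+q≈p f (t ·ₚ leader (suc k)))
      (D.+-closed (coeffwise∣ λ i → ∣ʳ-trans (lead-suc∣lead k) (∣coeff (lead∣ᶜ k f′∈J df′) i))
                  (D.·-closed t (lead∣ᶜleader k (lead∣ᶜ k))))
      where
      module D = IsIdealₚ (∣ᶜ-isIdealₚ (lead (suc k)))
      t = quotient (lead∣ (f , f∈J , df , refl))
      f′ = f -ₚ t ·ₚ leader (suc k)
      f′∈J : J f′
      f′∈J = sub-closed f∈J (·-closed t (leader∈J (suc k)))
      df′ : DegreeBelow (suc k) f′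
      df′ = degreeBelow-cancel t df (leader-degree (suc k))
              (trans (sym (equality (lead∣ (f , f∈J , df , refl)))) (*-congˡ (sym (leader-lead (suc k)))))

    monic-leader : ∀ k {y} → y * lead k ≈ 1# → Monic (y ·ₚ leader k) × J (y ·ₚ leader k)
    monic-leader k {y} y·lead≈1 =
      (k , trans (coeff-· y (leader k) k) (trans (*-congˡ (leader-lead k)) y·lead≈1) ,
           vanishes (degreeBelow-·ₚ y (leader-degree k))) ,
      ·-closed y (leader∈J k)

  module CoprimePair (f₁ f₂ : Poly) (coprime : ∀ g → Multiple g f₁ → Multiple g f₂ → Multiple g 1ₚ) where
    nonzero-constant₂ : ∃ λ d → ¬ d ≈ 0# × Generated₂ f₁ f₂ (const d)
    nonzero-constant₂ = nonzero-constant (generated₂-isIdealₚ f₁ f₂) λ g g∣I →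
      coprime g (g∣I (generated₂-left f₁ f₂)) (g∣I (generated₂-right f₁ f₂))

    monic₂ : ∀ {a} → ¬ a ≈ 0# → Generated₂ f₁ f₂ (const a) → ∃ λ h → Monic h × Generated₂ f₁ f₂ h
    monic₂ a≉0 a∈I = y ·ₚ leader K , monic-leader K y·lead≈1
      where
      open LeadingCoefficients (generated₂-isIdealₚ f₁ f₂) a≉0 a∈I
      K = length f₁ +ℕ length f₂
      const-lead∣ : ∀ f → Generated₂ f₁ f₂ f → length f ≤ K → Multiple (const (lead K)) f
      const-lead∣ f f∈I l≤K = ∣ᶜ⇒multiple-const
        (lead∣ᶜ K f∈I (degreeBelow-mono (≤-trans l≤K (n≤1+n K)) (degreeBelow-length f)))
      unit = const-unit (coprime (const (lead K))
        (const-lead∣ f₁ (generated₂-left f₁ f₂) (m≤m+n (length f₁) (length f₂)))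
        (const-lead∣ f₂ (generated₂-right f₁ f₂) (m≤n+m (length f₂) (length f₁))))
      y = proj₁ unit
      y·lead≈1 = proj₂ unit

corollary2p8 : ∀ {c ℓ : Level} (E : CommutativeRing c ℓ) → Ring.IsPID E →
    ∀ (f₁ f₂ : Ring.Poly E) → Ring.GcdOne E f₁ f₂ →
      ((∃ λ a → ¬ (Ring._≈_ E a (Ring.0# E)) × Ring.InIdeal₂ E f₁ f₂ (Ring.const E a))
      × (∃ λ h → Ring.Monic E h × Ring.InIdeal₂ E f₁ f₂ h))
      × (∀ a → ¬ (Ring._≈_ E a (Ring.0# E)) → Ring.InIdeal₂ E f₁ f₂ (Ring.const E a) →
          Ring.FiniteQuotient E a → Ring.FiniteQuotient₂ E f₁ f₂)
corollary2p8 E pid f₁ f₂ gcd =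
  ((d , d≉0 , toInIdeal₂ d∈I) , (h , h-monic , toInIdeal₂ h∈I)) , finite
  where
  open PrincipalIdealDomain E pid

  toInIdeal₂ : ∀ {h} → Generated₂ f₁ f₂ h → InIdeal₂ f₁ f₂ h
  toInIdeal₂ (g₁ , g₂ , e) = g₁ , g₂ , at e

  coprime : ∀ g → Multiple g f₁ → Multiple g f₂ → Multiple g 1ₚ
  coprime g (h₁ , e₁) (h₂ , e₂) = let u , e = gcd g (h₁ , at e₁) (h₂ , at e₂) in u , coeffwise e

  open CoprimePair f₁ f₂ coprime

  d = proj₁ nonzero-constant₂
  d≉0 = proj₁ (proj₂ nonzero-constant₂)
  d∈I = proj₂ (proj₂ nonzero-constant₂)
  h = proj₁ (monic₂ d≉0 d∈I)
  h-monic = proj₁ (proj₂ (monic₂ d≉0 d∈I))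
  h∈I = proj₂ (proj₂ (monic₂ d≉0 d∈I))

  finite : ∀ a → ¬ a ≈ 0# → InIdeal₂ f₁ f₂ (const a) → FiniteQuotient a → FiniteQuotient₂ f₁ f₂
  finite a a≉0 (g₁ , g₂ , e) fin =
    let hₐ , hₐ-monic , hₐ∈I = monic₂ a≉0 (g₁ , g₂ , coeffwise e)
        reps , cover = finite-quotient (generated₂-isIdealₚ f₁ f₂) (g₁ , g₂ , coeffwise e) hₐ-monic hₐ∈I fin
    in reps , λ p → Any.map toInIdeal₂ (cover p)
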